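{- For every $n\geq 0$ and every $P\in\mathcal{D}_n^{h,\geq}$, $$\#UDU(P)=\#FF(\phi(P))+\#FUD(\phi(P)).$$
   Context: A Motzkin path of length $n$ is a word in the steps $U=(1,1)$, $D=(1,-1)$, $F=(1,0)$ forming a lattice path from $(0,0)$ to $(n,0)$ never going below the $x$-axis; $\mathcal{M}_n$ is the set of them. A Dyck path of semilength $n$ is a Motzkin path of length $2n$ without $F$ steps. Every nonempty Dyck path has a unique first return decomposition $P=U\alpha D\beta$ with $\alpha,\beta$ Dyck paths; $h$ denotes maximal height. $\mathcal{D}^{h,\geq}$ is defined recursively: it contains the empty path $\epsilon$, and $P=U\alpha D\beta$ belongs to it iff $\alpha,\beta\in\mathcal{D}^{h,\geq}$ and $h(U\alpha D)\geq h(\beta)$; $\mathcal{D}_n^{h,\geq}$ is the subset of semilength $n$. The bijection $\phi:\mathcal{D}_n^{h,\geq}\to\mathcal{M}_n$ is defined by $\phi(\epsilon)=\epsilon$, $\phi(\alpha UD)=\phi(\alpha)F$, $\phi(\alpha UU\beta D\gamma D)=\phi(\alpha)\phi(\gamma)U\phi(\beta)D$. For a word $X$, $\#X(P)$ is the number of occurrences of $X$ as consecutive steps in $P$. -}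

module Defs where

open import Data.Nat using (ℕ; zero; suc; _+_; _≥_; _⊔_)
open import Data.List using (List; []; _∷_; _++_; [_])
open import Data.Product using (_×_; _,_)
open import Data.Bool using (Bool; true; false; _∧_; if_then_else_)
open import Data.Maybe using (Maybe; just; nothing)
open import Relation.Binary.PropositionalEquality using (_≡_)

-- Steps U = (1,1), D = (1,-1), F = (1,0)
data Step : Set where
  U D F : Step

Path : Set
Path = List Step

-- Dyck paths via the first-return decomposition:
-- ε is the empty path, node α β is the path U α D β.
data Dyck : Set where
  ε    : Dyck
  node : Dyck → Dyck → Dyck

word : Dyck → Path
word ε = []
word (node α β) = U ∷ word α ++ D ∷ word β

semilength : Dyck → ℕ
semilength ε = 0
semilength (node α β) = suc (semilength α + semilength β)

h : Dyck → ℕ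
h ε = 0
h (node α β) = suc (h α) ⊔ h β

data InDh : Dyck → Set where
  ε-in    : InDh ε
  node-in : ∀ {α β} → InDh α → InDh β → h (node α ε) ≥ h β → InDh (node α β)

data AboveFrom : ℕ → Path → Set where
  end : AboveFrom 0 []
  up  : ∀ {k w} → AboveFrom (suc k) w → AboveFrom k (U ∷ w)
  dn  : ∀ {k w} → AboveFrom k w → AboveFrom (suc k) (D ∷ w)
  fl  : ∀ {k w} → AboveFrom k w → AboveFrom k (F ∷ w)

IsMotzkin : Path → Set
IsMotzkin = AboveFrom 0

-- Last-return decomposition: a nonempty Dyck path P is written uniquely as
-- α U δ D with α, δ Dyck paths. lastDec P = just (α , δ).
snocD : Dyck → Dyck → Dyck      -- snocD α δ = α U δ D
snocD ε δ = node δ ε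
snocD (node α β) δ = node α (snocD β δ)

lastDec : Dyck → Maybe (Dyck × Dyck)
lastDec ε = nothing
lastDec (node α ε) = just (ε , α)
lastDec (node α (node β γ)) with lastDec (node β γ)
... | nothing       = nothing   -- impossible
... | just (α' , δ) = just (node α α' , δ)

-- φ with fuel (fuel ≥ semilength suffices, since every recursive call
-- is on a path of strictly smaller semilength):
--   φ(ε) = ε,  φ(α U D) = φ(α) F,  φ(α U U β D γ D) = φ(α) φ(γ) U φ(β) D.
φ-fuel : ℕ → Dyck → Path
φ-fuel zero    P = []
φ-fuel (suc k) P with lastDec P
... | nothing                = []
... | just (α , ε)           = φ-fuel k α ++ [ F ]
... | just (α , node β γ)    = φ-fuel k α ++ φ-fuel k γ ++ (U ∷ φ-fuel k β ++ [ D ])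

φ : Dyck → Path
φ P = φ-fuel (semilength P) P

isPrefix : Path → Path → Bool
isPrefix []      _        = true
isPrefix (_ ∷ _) []       = false
isPrefix (x ∷ xs) (y ∷ ys) = eqS x y ∧ isPrefix xs ys
  where
  eqS : Step → Step → Bool
  eqS U U = true
  eqS D D = true
  eqS F F = true
  eqS _ _ = false

count : Path → Path → ℕ
count X []       = 0
count X (y ∷ ys) = (if isPrefix X (y ∷ ys) then 1 else 0) + count X ys

-- Both sides are computed along the last-return decomposition P = α U δ D, which is
-- also the recursion of φ.  Occurrences of UDU, FF and FUD are additive across a
-- junction unless one straddles it.  In the word, junctions after α pass through DD
-- unless α ends in UD; the height condition of D^{h,≥} forbids α = α′UD before a
-- factor UUβDγD, so the only straddling occurrences are α′UD·UD (matched by the FF in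
-- φ(α′)F·F) and UUD·γ with γ ≠ ε (matched by the FUD in φ(γ)·UD, where the height
-- condition forces γ = (UD)ᵏ and φ(γ) = Fᵏ).  On the Motzkin side the junctions follow
-- an F or a D, and nothing straddles them because φ(β) never starts with D: φ(β) is a
-- Motzkin path.
module Submission where

open import Defs
open import Data.Nat using (ℕ; zero; suc; _+_; _≤_; _<_; z≤n; s≤s)
open import Data.Nat.Properties
open import Algebra.Properties.CommutativeSemigroup +-commutativeSemigroup using (interchange)
open import Data.Bool using (Bool; false; if_then_else_)
open import Data.Bool.Properties using (∧-zeroʳ)
open import Data.List using ([]; _∷_; _++_; [_]; _∷ʳ_; length)
open import Data.List.Properties using (++-assoc; ++-conicalʳ; length-++)
open import Data.List.Membership.Propositional using (_∉_)
open import Data.List.Relation.Unary.Any using (here; there)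
open import Data.Maybe using (just)
open import Data.Product using (_×_; _,_; proj₁; ∃-syntax)
open import Data.Empty using (⊥-elim)
open import Function using (_∘_)
open import Relation.Nullary using (¬_)
open import Relation.Binary.PropositionalEquality hiding ([_])

-- The step comparison inside isPrefix is local to it and takes the compared
-- tails as parameters, so heads have to be split before tails can be changed.
isPrefix-∷-cong : ∀ x y xs ys xs′ ys′ → isPrefix xs ys ≡ isPrefix xs′ ys′ →
                  isPrefix (x ∷ xs) (y ∷ ys) ≡ isPrefix (x ∷ xs′) (y ∷ ys′)
isPrefix-∷-cong U U _ _ _ _ eq = eq
isPrefix-∷-cong D D _ _ _ _ eq = eq
isPrefix-∷-cong F F _ _ _ _ eq = eq
isPrefix-∷-cong U D _ _ _ _ _ = refl
isPrefix-∷-cong U F _ _ _ _ _ = refl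
isPrefix-∷-cong D U _ _ _ _ _ = refl
isPrefix-∷-cong D F _ _ _ _ _ = refl
isPrefix-∷-cong F U _ _ _ _ _ = refl
isPrefix-∷-cong F D _ _ _ _ _ = refl

isPrefix-∷-≢ : ∀ {x y} xs ys → x ≢ y → isPrefix (x ∷ xs) (y ∷ ys) ≡ false
isPrefix-∷-≢ {U} {U} _ _ x≢y = ⊥-elim (x≢y refl)
isPrefix-∷-≢ {D} {D} _ _ x≢y = ⊥-elim (x≢y refl)
isPrefix-∷-≢ {F} {F} _ _ x≢y = ⊥-elim (x≢y refl)
isPrefix-∷-≢ {U} {D} _ _ _ = refl
isPrefix-∷-≢ {U} {F} _ _ _ = refl
isPrefix-∷-≢ {D} {U} _ _ _ = refl
isPrefix-∷-≢ {D} {F} _ _ _ = refl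
isPrefix-∷-≢ {F} {U} _ _ _ = refl
isPrefix-∷-≢ {F} {D} _ _ _ = refl

isPrefix-∷ʳ-[] : ∀ {t} X → isPrefix (X ∷ʳ t) [] ≡ false
isPrefix-∷ʳ-[] []      = refl
isPrefix-∷ʳ-[] (_ ∷ _) = refl

isPrefix-++-long : ∀ X ys zs → length X ≤ length ys → isPrefix X (ys ++ zs) ≡ isPrefix X ys
isPrefix-++-long []      _        _  _        = refl
isPrefix-++-long (x ∷ X) (y ∷ ys) zs (s≤s le) =
  isPrefix-∷-cong x y X (ys ++ zs) X ys (isPrefix-++-long X ys zs le)

isPrefix-++-interior : ∀ {r s} I ys zs → s ∉ I →
                       isPrefix (I ∷ʳ r) ((ys ∷ʳ s) ++ zs) ≡ isPrefix (I ∷ʳ r) (ys ∷ʳ s)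
isPrefix-++-interior []      []       _  _   = refl
isPrefix-++-interior []      (_ ∷ _)  _  _   = refl
isPrefix-++-interior {r} {s} (i ∷ I) [] zs s∉I =
  trans (isPrefix-∷-≢ (I ∷ʳ r) zs i≢s) (sym (isPrefix-∷-≢ (I ∷ʳ r) [] i≢s))
  where
  i≢s : i ≢ s
  i≢s i≡s = s∉I (here (sym i≡s))
isPrefix-++-interior {r} {s} (i ∷ I) (y ∷ ys) zs s∉I =
  isPrefix-∷-cong i y (I ∷ʳ r) ((ys ∷ʳ s) ++ zs) (I ∷ʳ r) (ys ∷ʳ s)
    (isPrefix-++-interior I ys zs (s∉I ∘ there))

isPrefix-∷ʳ-≢ : ∀ {t s} X ys → t ≢ s → isPrefix (X ∷ʳ t) (ys ∷ʳ s) ≡ isPrefix (X ∷ʳ t) ys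
isPrefix-∷ʳ-≢     []      []       t≢s = isPrefix-∷-≢ [] [] t≢s
isPrefix-∷ʳ-≢     []      (_ ∷ _)  _   = refl
isPrefix-∷ʳ-≢ {t} (_ ∷ X) []       _   rewrite isPrefix-∷ʳ-[] {t} X = ∧-zeroʳ _
isPrefix-∷ʳ-≢ {t} {s} (x ∷ X) (y ∷ ys) t≢s =
  isPrefix-∷-cong x y (X ∷ʳ t) (ys ∷ʳ s) (X ∷ʳ t) ys (isPrefix-∷ʳ-≢ X ys t≢s)

indicator : Bool → ℕ
indicator b = if b then 1 else 0

count-∷ʳ-≢ : ∀ {t s} X A → t ≢ s → count (X ∷ʳ t) (A ∷ʳ s) ≡ count (X ∷ʳ t) A
count-∷ʳ-≢ X []      t≢s =
  cong (λ b → indicator b + 0) (trans (isPrefix-∷ʳ-≢ X [] t≢s) (isPrefix-∷ʳ-[] X))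
count-∷ʳ-≢ X (a ∷ A) t≢s =
  cong₂ (λ b n → indicator b + n) (isPrefix-∷ʳ-≢ X (a ∷ A) t≢s) (count-∷ʳ-≢ X A t≢s)

NoStraddle : Path → Path → Path → Set
NoStraddle X T B = ∀ y ys → isPrefix X ((y ∷ ys ++ T) ++ B) ≡ isPrefix X (y ∷ ys ++ T)

count-++ : ∀ X A T B → NoStraddle X T B →
           count X ((A ++ T) ++ B) + count X T ≡ count X (A ++ T) + count X (T ++ B)
count-++ X []      T B _      = +-comm (count X (T ++ B)) (count X T)
count-++ X (a ∷ A) T B noStr = begin
  (occ ((a ∷ A ++ T) ++ B) + count X ((A ++ T) ++ B)) + count X T
    ≡⟨ +-assoc (occ ((a ∷ A ++ T) ++ B)) _ _ ⟩
  occ ((a ∷ A ++ T) ++ B) + (count X ((A ++ T) ++ B) + count X T)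
    ≡⟨ cong₂ _+_ (cong indicator (noStr a A)) (count-++ X A T B noStr) ⟩
  occ (a ∷ A ++ T) + (count X (A ++ T) + count X (T ++ B))
    ≡⟨ +-assoc (occ (a ∷ A ++ T)) _ _ ⟨
  (occ (a ∷ A ++ T) + count X (A ++ T)) + count X (T ++ B) ∎
  where
  open ≡-Reasoning
  occ = indicator ∘ isPrefix X

count-++-long : ∀ X A T B → length X ≤ suc (length T) →
                count X ((A ++ T) ++ B) + count X T ≡ count X (A ++ T) + count X (T ++ B)
count-++-long X A T B le = count-++ X A T B noStraddle
  where
  noStraddle : NoStraddle X T B
  noStraddle _ ys = isPrefix-++-long X (_ ∷ ys ++ T) B
    (≤-trans le (s≤s (subst (length T ≤_) (sym (length-++ ys)) (m≤n+m _ _))))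

count-++-interior : ∀ {t r s} I A Z → s ∉ I →
  count (t ∷ I ∷ʳ r) ((A ∷ʳ s) ++ Z)
    ≡ count (t ∷ I ∷ʳ r) (A ∷ʳ s) + count (t ∷ I ∷ʳ r) (s ∷ Z)
count-++-interior {t} {r} {s} I A Z s∉I = begin
  count X ((A ∷ʳ s) ++ Z)                 ≡⟨ +-identityʳ _ ⟨
  count X ((A ∷ʳ s) ++ Z) + 0             ≡⟨ cong (count X ((A ∷ʳ s) ++ Z) +_) single ⟨
  count X ((A ∷ʳ s) ++ Z) + count X [ s ] ≡⟨ count-++ X A [ s ] Z noStraddle ⟩
  count X (A ∷ʳ s) + count X (s ∷ Z)      ∎
  where
  open ≡-Reasoning
  X = t ∷ I ∷ʳ r
  single : count X [ s ] ≡ 0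
  single rewrite isPrefix-∷ʳ-[] {r} I = cong (λ b → indicator b + 0) (∧-zeroʳ _)
  noStraddle : NoStraddle X [ s ] Z
  noStraddle y ys = isPrefix-∷-cong t y (I ∷ʳ r) ((ys ∷ʳ s) ++ Z) (I ∷ʳ r) (ys ∷ʳ s)
                      (isPrefix-++-interior I ys Z s∉I)

#UDU : Path → ℕ
#UDU = count (U ∷ D ∷ U ∷ [])

#FF+#FUD : Path → ℕ
#FF+#FUD w = count (F ∷ F ∷ []) w + count (F ∷ U ∷ D ∷ []) w

#UDU-∷ʳD : ∀ w → #UDU (w ∷ʳ D) ≡ #UDU w
#UDU-∷ʳD w = count-∷ʳ-≢ {U} {D} (U ∷ D ∷ []) w (λ ())

#UDU-DD-++ : ∀ W R → #UDU ((W ++ D ∷ D ∷ []) ++ R) ≡ #UDU (W ++ D ∷ D ∷ []) + #UDU R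
#UDU-DD-++ W R =
  trans (sym (+-identityʳ _)) (count-++-long (U ∷ D ∷ U ∷ []) W (D ∷ D ∷ []) R ≤-refl)

#UDU-UD-UD : ∀ W → #UDU ((W ++ U ∷ D ∷ []) ++ U ∷ D ∷ []) ≡ #UDU (W ++ U ∷ D ∷ []) + 1
#UDU-UD-UD W =
  trans (sym (+-identityʳ _)) (count-++-long (U ∷ D ∷ U ∷ []) W (U ∷ D ∷ []) (U ∷ D ∷ []) ≤-refl)

#UDU-∷ʳD-++-D∷ : ∀ X Z → #UDU ((X ∷ʳ D) ++ D ∷ Z) ≡ #UDU (X ∷ʳ D) + #UDU Z
#UDU-∷ʳD-++-D∷ X Z = begin
  #UDU ((X ∷ʳ D) ++ D ∷ Z)               ≡⟨ cong #UDU (++-assoc X [ D ] (D ∷ Z)) ⟩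
  #UDU (X ++ D ∷ D ∷ Z)                  ≡⟨ cong #UDU (++-assoc X (D ∷ D ∷ []) Z) ⟨
  #UDU ((X ++ D ∷ D ∷ []) ++ Z)          ≡⟨ #UDU-DD-++ X Z ⟩
  #UDU (X ++ D ∷ D ∷ []) + #UDU Z        ≡⟨ cong (λ w → #UDU w + #UDU Z) (++-assoc X [ D ] [ D ]) ⟨
  #UDU ((X ∷ʳ D) ∷ʳ D) + #UDU Z          ≡⟨ cong (_+ #UDU Z) (#UDU-∷ʳD (X ∷ʳ D)) ⟩
  #UDU (X ∷ʳ D) + #UDU Z                 ∎
  where open ≡-Reasoning

#FF+#FUD-split : ∀ {s} → s ≢ U → ∀ X Z →
  #FF+#FUD ((X ∷ʳ s) ++ Z) ≡ #FF+#FUD (X ∷ʳ s) + #FF+#FUD (s ∷ Z)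
#FF+#FUD-split {s} s≢U X Z = begin
  #FF+#FUD ((X ∷ʳ s) ++ Z)
    ≡⟨ cong₂ _+_ (count-++-interior {F} {F} [] X Z λ ())
                 (count-++-interior {F} {D} (U ∷ []) X Z s∉U) ⟩
  (ff (X ∷ʳ s) + ff (s ∷ Z)) + (fud (X ∷ʳ s) + fud (s ∷ Z))
    ≡⟨ interchange (ff (X ∷ʳ s)) (ff (s ∷ Z)) (fud (X ∷ʳ s)) (fud (s ∷ Z)) ⟩
  #FF+#FUD (X ∷ʳ s) + #FF+#FUD (s ∷ Z) ∎
  where
  open ≡-Reasoning
  ff fud : Path → ℕ
  ff = count (F ∷ F ∷ [])
  fud = count (F ∷ U ∷ D ∷ [])
  s∉U : s ∉ U ∷ []
  s∉U (here s≡U) = s≢U s≡U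

semilength-snocD : ∀ α δ → semilength (snocD α δ) ≡ suc (semilength α + semilength δ)
semilength-snocD ε          δ = cong suc (+-identityʳ (semilength δ))
semilength-snocD (node a b) δ = cong suc (begin
  semilength a + semilength (snocD b δ)              ≡⟨ cong (semilength a +_) (semilength-snocD b δ) ⟩
  semilength a + suc (semilength b + semilength δ)   ≡⟨ +-suc (semilength a) _ ⟩
  suc (semilength a + (semilength b + semilength δ)) ≡⟨ cong suc (+-assoc (semilength a) _ _) ⟨
  suc (semilength a + semilength b + semilength δ)   ∎)
  where open ≡-Reasoning

lastDec-snocD : ∀ α δ → lastDec (snocD α δ) ≡ just (α , δ)
lastDec-snocD ε                   δ = refl
lastDec-snocD (node a ε)          δ = refl
lastDec-snocD (node a (node b c)) δ rewrite lastDec-snocD (node b c) δ = refl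

word-snocD : ∀ α δ → word (snocD α δ) ≡ word α ++ U ∷ word δ ++ D ∷ []
word-snocD ε          δ = refl
word-snocD (node a b) δ = cong (U ∷_) (begin
  word a ++ D ∷ word (snocD b δ)                 ≡⟨ cong (λ w → word a ++ D ∷ w) (word-snocD b δ) ⟩
  word a ++ D ∷ word b ++ U ∷ word δ ++ D ∷ []   ≡⟨ ++-assoc (word a) (D ∷ word b) _ ⟨
  (word a ++ D ∷ word b) ++ U ∷ word δ ++ D ∷ [] ∎)
  where open ≡-Reasoning

word-snocD-∷ʳ : ∀ α δ → word (snocD α δ) ≡ (word α ++ U ∷ word δ) ∷ʳ D
word-snocD-∷ʳ α δ = trans (word-snocD α δ) (sym (++-assoc (word α) (U ∷ word δ) [ D ]))

word-node-∷ʳ : ∀ β γ → ∃[ W ] word (node β γ) ≡ W ∷ʳ D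
word-node-∷ʳ β ε          = U ∷ word β , refl
word-node-∷ʳ β (node b g) with word-node-∷ʳ b g
... | W , eq = U ∷ word β ++ D ∷ W ,
  trans (cong (λ w → U ∷ word β ++ D ∷ w) eq) (cong (U ∷_) (sym (++-assoc (word β) (D ∷ W) [ D ])))

word-snocUUDD : ∀ α β γ → ∃[ W ] word (snocD α (node β γ)) ≡ W ++ D ∷ D ∷ []
word-snocUUDD α β γ with word-node-∷ʳ β γ
... | W , eq = word α ++ U ∷ W , (begin
  word (snocD α (node β γ))               ≡⟨ word-snocD α (node β γ) ⟩
  word α ++ U ∷ word (node β γ) ++ D ∷ [] ≡⟨ cong (λ w → word α ++ U ∷ w ++ D ∷ []) eq ⟩
  word α ++ U ∷ (W ∷ʳ D) ++ D ∷ []        ≡⟨ cong ((word α ++_) ∘ (U ∷_)) (++-assoc W [ D ] [ D ]) ⟩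
  word α ++ U ∷ W ++ D ∷ D ∷ []           ≡⟨ ++-assoc (word α) (U ∷ W) _ ⟨
  (word α ++ U ∷ W) ++ D ∷ D ∷ []         ∎)
  where open ≡-Reasoning

#UDU-UD-word : ∀ α δ Z → #UDU (U ∷ D ∷ word (snocD α δ) ++ Z) ≡ suc (#UDU (word (snocD α δ) ++ Z))
#UDU-UD-word ε          _ _ = refl
#UDU-UD-word (node _ _) _ _ = refl

#UDU-UU-word : ∀ α δ Z → #UDU (U ∷ U ∷ word (snocD α δ) ++ Z) ≡ #UDU (word (snocD α δ) ++ Z)
#UDU-UU-word ε          _ _ = refl
#UDU-UU-word (node _ _) _ _ = refl

#UDU-word-++-D∷ : ∀ α δ Z → #UDU (word (snocD α δ) ++ D ∷ Z) ≡ #UDU (word (snocD α δ)) + #UDU Z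
#UDU-word-++-D∷ α δ Z rewrite word-snocD-∷ʳ α δ = #UDU-∷ʳD-++-D∷ (word α ++ U ∷ word δ) Z

h≤h-snocD : ∀ α δ → h α ≤ h (snocD α δ)
h≤h-snocD ε          _ = z≤n
h≤h-snocD (node a b) δ = ⊔-monoʳ-≤ (suc (h a)) (h≤h-snocD b δ)

h<h-snocD : ∀ α δ → h δ < h (snocD α δ)
h<h-snocD ε          δ = ≤-refl
h<h-snocD (node a b) δ = ≤-trans (h<h-snocD b δ) (m≤n⊔m (suc (h a)) _)

1≤h-node : ∀ β γ → 1 ≤ h (node β γ)
1≤h-node β γ = ≤-trans (s≤s z≤n) (m≤m⊔n (suc (h β)) (h γ))

InDh-snocD : ∀ α δ → InDh (snocD α δ) → InDh α × InDh δ
InDh-snocD ε          δ (node-in iδ _ _) = ε-in , iδ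
InDh-snocD (node a b) δ (node-in ia ib le) with InDh-snocD b δ ib
... | ib′ , iδ = node-in ia ib′ (≤-trans (h≤h-snocD b δ) le) , iδ

InDh-snocD-UD-UU : ∀ α β γ → ¬ InDh (snocD (snocD α ε) (node β γ))
InDh-snocD-UD-UU ε          β γ (node-in _ _ le) = ≤⇒≯ le (s≤s (1≤h-node β γ))
InDh-snocD-UD-UU (node _ b) β γ (node-in _ i _)  = InDh-snocD-UD-UU b β γ i

-- snocD α ε = α U D and snocD α (node β γ) = α U U β D γ D: the three clauses of φ.
data LastReturn : Dyck → Set where
  ε        : LastReturn ε
  snocUD   : ∀ {α} → LastReturn α → LastReturn (snocD α ε)
  snocUUDD : ∀ {α β γ} → LastReturn α → LastReturn β → LastReturn γ →
             LastReturn (snocD α (node β γ))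

-- Prepending U α D commutes with snocD, so only subterms of α are decomposed afresh.
mutual
  lastReturn : ∀ P → LastReturn P
  lastReturn ε          = ε
  lastReturn (node α β) = lastReturn-node α (lastReturn β)

  lastReturn-node : ∀ α {β} → LastReturn β → LastReturn (node α β)
  lastReturn-node ε          ε                  = snocUD ε
  lastReturn-node (node b g) ε                  = snocUUDD ε (lastReturn b) (lastReturn g)
  lastReturn-node α          (snocUD v)         = snocUD (lastReturn-node α v)
  lastReturn-node α          (snocUUDD v vβ vγ) = snocUUDD (lastReturn-node α v) vβ vγ

φ-fuel-ε : ∀ k → φ-fuel k ε ≡ []
φ-fuel-ε zero    = refl
φ-fuel-ε (suc k) = refl

φ-fuel-snocUD : ∀ k α → φ-fuel (suc k) (snocD α ε) ≡ φ-fuel k α ∷ʳ F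
φ-fuel-snocUD k α rewrite lastDec-snocD α ε = refl

φ-fuel-snocUUDD : ∀ k α β γ →
  φ-fuel (suc k) (snocD α (node β γ)) ≡ φ-fuel k α ++ φ-fuel k γ ++ U ∷ φ-fuel k β ++ D ∷ []
φ-fuel-snocUUDD k α β γ rewrite lastDec-snocD α (node β γ) = refl

snocD-fuel : ∀ {α δ j} → semilength (snocD α δ) ≤ j →
             ∃[ k ] j ≡ suc k × semilength α ≤ k × semilength δ ≤ k
snocD-fuel {α} {δ} le with subst (_≤ _) (semilength-snocD α δ) le
... | s≤s le′ = _ , refl , m+n≤o⇒m≤o _ le′ , m+n≤o⇒n≤o _ le′

node-fuel : ∀ {β γ k} → semilength (node β γ) ≤ k → semilength β ≤ k × semilength γ ≤ k
node-fuel {β} (s≤s le) = ≤-trans (m+n≤o⇒m≤o (semilength β) le) (n≤1+n _)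
                       , ≤-trans (m+n≤o⇒n≤o (semilength β) le) (n≤1+n _)

φ-fuel-irrelevant : ∀ {P} → LastReturn P → ∀ {j k} → semilength P ≤ j → semilength P ≤ k →
                    φ-fuel j P ≡ φ-fuel k P
φ-fuel-irrelevant ε {j} {k} _ _ = trans (φ-fuel-ε j) (sym (φ-fuel-ε k))
φ-fuel-irrelevant (snocUD {α} vα) p q with snocD-fuel p | snocD-fuel q
... | j , refl , pα , _ | k , refl , qα , _ = begin
  φ-fuel (suc j) (snocD α ε) ≡⟨ φ-fuel-snocUD j α ⟩
  φ-fuel j α ∷ʳ F            ≡⟨ cong (_∷ʳ F) (φ-fuel-irrelevant vα pα qα) ⟩
  φ-fuel k α ∷ʳ F            ≡⟨ φ-fuel-snocUD k α ⟨
  φ-fuel (suc k) (snocD α ε) ∎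
  where open ≡-Reasoning
φ-fuel-irrelevant (snocUUDD {α} {β} {γ} vα vβ vγ) p q with snocD-fuel p | snocD-fuel q
... | j , refl , pα , pδ | k , refl , qα , qδ with node-fuel {β} pδ | node-fuel {β} qδ
... | pβ , pγ | qβ , qγ = begin
  φ-fuel (suc j) (snocD α (node β γ))
    ≡⟨ φ-fuel-snocUUDD j α β γ ⟩
  φ-fuel j α ++ φ-fuel j γ ++ U ∷ φ-fuel j β ++ D ∷ []
    ≡⟨ cong₂ _++_ (φ-fuel-irrelevant vα pα qα)
         (cong₂ _++_ (φ-fuel-irrelevant vγ pγ qγ)
           (cong (λ w → U ∷ w ++ D ∷ []) (φ-fuel-irrelevant vβ pβ qβ))) ⟩
  φ-fuel k α ++ φ-fuel k γ ++ U ∷ φ-fuel k β ++ D ∷ []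
    ≡⟨ φ-fuel-snocUUDD k α β γ ⟨
  φ-fuel (suc k) (snocD α (node β γ))
    ∎
  where open ≡-Reasoning

φ-fuel-≥ : ∀ P {k} → semilength P ≤ k → φ-fuel k P ≡ φ P
φ-fuel-≥ P le = φ-fuel-irrelevant (lastReturn P) le ≤-refl

φ-snocUD : ∀ α → φ (snocD α ε) ≡ φ α ∷ʳ F
φ-snocUD α = begin
  φ (snocD α ε)
    ≡⟨ φ-fuel-≥ (snocD α ε) (≤-reflexive (semilength-snocD α ε)) ⟨
  φ-fuel (suc (semilength α + 0)) (snocD α ε)
    ≡⟨ φ-fuel-snocUD _ α ⟩
  φ-fuel (semilength α + 0) α ∷ʳ F
    ≡⟨ cong (_∷ʳ F) (φ-fuel-≥ α (m≤m+n _ _)) ⟩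
  φ α ∷ʳ F
    ∎
  where open ≡-Reasoning

φ-snocUUDD : ∀ α β γ → φ (snocD α (node β γ)) ≡ φ α ++ φ γ ++ U ∷ φ β ++ D ∷ []
φ-snocUUDD α β γ with node-fuel {β} {γ} (m≤n+m (semilength (node β γ)) (semilength α))
... | βk , γk = begin
  φ (snocD α (node β γ))
    ≡⟨ φ-fuel-≥ (snocD α (node β γ)) (≤-reflexive (semilength-snocD α (node β γ))) ⟨
  φ-fuel (suc k) (snocD α (node β γ))
    ≡⟨ φ-fuel-snocUUDD k α β γ ⟩
  φ-fuel k α ++ φ-fuel k γ ++ U ∷ φ-fuel k β ++ D ∷ []
    ≡⟨ cong₂ _++_ (φ-fuel-≥ α (m≤m+n _ _))
         (cong₂ _++_ (φ-fuel-≥ γ γk) (cong (λ w → U ∷ w ++ D ∷ []) (φ-fuel-≥ β βk))) ⟩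
  φ α ++ φ γ ++ U ∷ φ β ++ D ∷ []
    ∎
  where
  open ≡-Reasoning
  k = semilength α + semilength (node β γ)

φ-snocUUDD-∷ʳ : ∀ α β γ → φ (snocD α (node β γ)) ≡ (φ α ++ φ γ ++ U ∷ φ β) ∷ʳ D
φ-snocUUDD-∷ʳ α β γ = trans (φ-snocUUDD α β γ) (sym (trans
  (++-assoc (φ α) (φ γ ++ U ∷ φ β) [ D ]) (cong (φ α ++_) (++-assoc (φ γ) (U ∷ φ β) [ D ]))))

φ-snocD-≢-[] : ∀ α δ → φ (snocD α δ) ≢ []
φ-snocD-≢-[] α ε eq with ++-conicalʳ (φ α) [ F ] (trans (sym (φ-snocUD α)) eq)
... | ()
φ-snocD-≢-[] α (node β γ) eq with ++-conicalʳ _ [ D ] (trans (sym (φ-snocUUDD-∷ʳ α β γ)) eq)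
... | ()

AboveFrom-++ : ∀ {j k w v} → AboveFrom j w → AboveFrom k v → AboveFrom (j + k) (w ++ v)
AboveFrom-++ end    v = v
AboveFrom-++ (up a) v = up (AboveFrom-++ a v)
AboveFrom-++ (dn a) v = dn (AboveFrom-++ a v)
AboveFrom-++ (fl a) v = fl (AboveFrom-++ a v)

φ-isMotzkin : ∀ {P} → LastReturn P → IsMotzkin (φ P)
φ-isMotzkin ε = end
φ-isMotzkin (snocUD {α} vα) =
  subst IsMotzkin (sym (φ-snocUD α)) (AboveFrom-++ (φ-isMotzkin vα) (fl end))
φ-isMotzkin (snocUUDD {α} {β} {γ} vα vβ vγ) =
  subst IsMotzkin (sym (φ-snocUUDD α β γ))
    (AboveFrom-++ (φ-isMotzkin vα)
      (AboveFrom-++ (φ-isMotzkin vγ) (up (AboveFrom-++ (φ-isMotzkin vβ) (dn end)))))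

#FF+#FUD-FU-motzkin : ∀ {w} → IsMotzkin w → w ≢ [] → ∀ Z →
                      #FF+#FUD (F ∷ U ∷ w ++ Z) ≡ #FF+#FUD (w ++ Z)
#FF+#FUD-FU-motzkin end    w≢[] _ = ⊥-elim (w≢[] refl)
#FF+#FUD-FU-motzkin (up _) _    _ = refl
#FF+#FUD-FU-motzkin (fl _) _    _ = refl

#FF+#FUD-φ-∷ʳD : ∀ {β} → LastReturn β → #FF+#FUD (φ β ∷ʳ D) ≡ #FF+#FUD (φ β)
#FF+#FUD-φ-∷ʳD ε = refl
#FF+#FUD-φ-∷ʳD (snocUD {α} _) rewrite φ-snocUD α =
  trans (#FF+#FUD-split (λ ()) (φ α) [ D ]) (+-identityʳ _)
#FF+#FUD-φ-∷ʳD (snocUUDD {α} {β} {γ} _ _ _) rewrite φ-snocUUDD-∷ʳ α β γ =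
  trans (#FF+#FUD-split (λ ()) (φ α ++ φ γ ++ U ∷ φ β) [ D ]) (+-identityʳ _)

#FF+#FUD-φ-++-U∷-motzkin : ∀ {γ} → LastReturn γ → ∀ {w} → IsMotzkin w → w ≢ [] → ∀ Z →
  #FF+#FUD (φ γ ++ U ∷ w ++ Z) ≡ #FF+#FUD (φ γ) + #FF+#FUD (w ++ Z)
#FF+#FUD-φ-++-U∷-motzkin ε _ _ _ = refl
#FF+#FUD-φ-++-U∷-motzkin (snocUD {α} _) m w≢[] Z rewrite φ-snocUD α =
  trans (#FF+#FUD-split (λ ()) (φ α) _)
        (cong (#FF+#FUD (φ α ∷ʳ F) +_) (#FF+#FUD-FU-motzkin m w≢[] Z))
#FF+#FUD-φ-++-U∷-motzkin (snocUUDD {α} {β} {γ} _ _ _) {w} _ _ Z rewrite φ-snocUUDD-∷ʳ α β γ =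
  #FF+#FUD-split (λ ()) (φ α ++ φ γ ++ U ∷ φ β) (U ∷ w ++ Z)

Separating : Dyck → Set
Separating α = (∀ R → #UDU (word α ++ R) ≡ #UDU (word α) + #UDU R)
             × (∀ S → #FF+#FUD (φ α ++ S) ≡ #FF+#FUD (φ α) + #FF+#FUD S)

ε-separating : Separating ε
ε-separating = (λ _ → refl) , (λ _ → refl)

snocUUDD-separating : ∀ α β γ → Separating (snocD α (node β γ))
snocUUDD-separating α β γ with word-snocUUDD α β γ
... | W , eq rewrite eq | φ-snocUUDD-∷ʳ α β γ =
  #UDU-DD-++ W , #FF+#FUD-split (λ ()) (φ α ++ φ γ ++ U ∷ φ β)

separating : ∀ {α β γ} → LastReturn α → InDh (snocD α (node β γ)) → Separating α
separating                ε                            _ = ε-separating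
separating {β = β} {γ}    (snocUD {α} _)               i = ⊥-elim (InDh-snocD-UD-UU α β γ i)
separating                (snocUUDD {α} {b} {g} _ _ _) _ = snocUUDD-separating α b g

lastFactor-ε : ∀ {γ} → LastReturn γ → h γ ≤ 1 → #UDU (word γ) ≡ #FF+#FUD (φ γ) →
  #UDU (U ∷ word (node ε γ) ++ D ∷ []) ≡ #FF+#FUD (φ γ ++ U ∷ φ ε ++ D ∷ [])
lastFactor-ε ε _ _ = refl
lastFactor-ε (snocUD {γ} _) _ ih = begin
  #UDU (U ∷ D ∷ word (snocD γ ε) ++ D ∷ [])    ≡⟨ #UDU-UD-word γ ε [ D ] ⟩
  suc (#UDU (word (snocD γ ε) ∷ʳ D))           ≡⟨ cong suc (#UDU-∷ʳD (word (snocD γ ε))) ⟩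
  suc (#UDU (word (snocD γ ε)))                ≡⟨ cong suc ih ⟩
  suc (#FF+#FUD (φ (snocD γ ε)))               ≡⟨ +-comm 1 _ ⟩
  #FF+#FUD (φ (snocD γ ε)) + 1                 ≡⟨ cong (λ w → #FF+#FUD w + 1) (φ-snocUD γ) ⟩
  #FF+#FUD (φ γ ∷ʳ F) + 1                     ≡⟨ #FF+#FUD-split (λ ()) (φ γ) (U ∷ D ∷ []) ⟨
  #FF+#FUD ((φ γ ∷ʳ F) ++ U ∷ D ∷ [])          ≡⟨ cong (#FF+#FUD ∘ (_++ U ∷ D ∷ [])) (φ-snocUD γ) ⟨
  #FF+#FUD (φ (snocD γ ε) ++ U ∷ D ∷ [])       ∎
  where open ≡-Reasoning
lastFactor-ε (snocUUDD {γ} {b} {g} _ _ _) h≤1 _ =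
  ⊥-elim (≤⇒≯ h≤1 (≤-trans (s≤s (1≤h-node b g)) (h<h-snocD γ (node b g))))

lastFactor-snocD : ∀ β δ {γ} → LastReturn γ →
  #UDU (word (snocD β δ)) ≡ #FF+#FUD (φ (snocD β δ)) → #UDU (word γ) ≡ #FF+#FUD (φ γ) →
  #UDU (U ∷ word (node (snocD β δ) γ) ++ D ∷ []) ≡ #FF+#FUD (φ γ ++ U ∷ φ (snocD β δ) ++ D ∷ [])
lastFactor-snocD β δ {γ} vγ ihβ ihγ = begin
  #UDU ((U ∷ U ∷ word β′ ++ D ∷ word γ) ∷ʳ D)
    ≡⟨ #UDU-∷ʳD (U ∷ U ∷ word β′ ++ D ∷ word γ) ⟩
  #UDU (U ∷ U ∷ word β′ ++ D ∷ word γ)         ≡⟨ #UDU-UU-word β δ (D ∷ word γ) ⟩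
  #UDU (word β′ ++ D ∷ word γ)                 ≡⟨ #UDU-word-++-D∷ β δ (word γ) ⟩
  #UDU (word β′) + #UDU (word γ)               ≡⟨ cong₂ _+_ ihβ ihγ ⟩
  #FF+#FUD (φ β′) + #FF+#FUD (φ γ)             ≡⟨ +-comm (#FF+#FUD (φ β′)) _ ⟩
  #FF+#FUD (φ γ) + #FF+#FUD (φ β′)
    ≡⟨ cong (#FF+#FUD (φ γ) +_) (#FF+#FUD-φ-∷ʳD (lastReturn β′)) ⟨
  #FF+#FUD (φ γ) + #FF+#FUD (φ β′ ∷ʳ D)
    ≡⟨ #FF+#FUD-φ-++-U∷-motzkin vγ (φ-isMotzkin (lastReturn β′)) (φ-snocD-≢-[] β δ) [ D ] ⟨
  #FF+#FUD (φ γ ++ U ∷ φ β′ ∷ʳ D)              ∎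
  where
  open ≡-Reasoning
  β′ = snocD β δ

lastFactor : ∀ {β γ} → LastReturn β → LastReturn γ → h γ ≤ h (node β ε) →
  #UDU (word β) ≡ #FF+#FUD (φ β) → #UDU (word γ) ≡ #FF+#FUD (φ γ) →
  #UDU (U ∷ word (node β γ) ++ D ∷ []) ≡ #FF+#FUD (φ γ ++ U ∷ φ β ++ D ∷ [])
lastFactor ε                            vγ h≤ _   ihγ = lastFactor-ε vγ h≤ ihγ
lastFactor (snocUD {β} _)               vγ _  ihβ ihγ = lastFactor-snocD β ε vγ ihβ ihγ
lastFactor (snocUUDD {β} {b} {g} _ _ _) vγ _  ihβ ihγ = lastFactor-snocD β (node b g) vγ ihβ ihγ

trailing-UD : ∀ α → Separating α → #UDU (word α) ≡ #FF+#FUD (φ α) →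
              #UDU (word (snocD α ε)) ≡ #FF+#FUD (φ (snocD α ε))
trailing-UD α (#UDU-additive , #FF+#FUD-additive) ih = begin
  #UDU (word (snocD α ε))          ≡⟨ cong #UDU (word-snocD α ε) ⟩
  #UDU (word α ++ U ∷ D ∷ [])      ≡⟨ #UDU-additive (U ∷ D ∷ []) ⟩
  #UDU (word α) + 0                ≡⟨ cong (_+ 0) ih ⟩
  #FF+#FUD (φ α) + #FF+#FUD [ F ]  ≡⟨ #FF+#FUD-additive [ F ] ⟨
  #FF+#FUD (φ α ∷ʳ F)              ≡⟨ cong #FF+#FUD (φ-snocUD α) ⟨
  #FF+#FUD (φ (snocD α ε))         ∎
  where open ≡-Reasoning

trailing-UDUD : ∀ α → #UDU (word (snocD α ε)) ≡ #FF+#FUD (φ (snocD α ε)) →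
                #UDU (word (snocD (snocD α ε) ε)) ≡ #FF+#FUD (φ (snocD (snocD α ε) ε))
trailing-UDUD α ih = begin
  #UDU (word (snocD (snocD α ε) ε))             ≡⟨ cong #UDU (word-snocD (snocD α ε) ε) ⟩
  #UDU (word (snocD α ε) ++ U ∷ D ∷ [])         ≡⟨ cong (#UDU ∘ (_++ U ∷ D ∷ [])) (word-snocD α ε) ⟩
  #UDU ((word α ++ U ∷ D ∷ []) ++ U ∷ D ∷ [])   ≡⟨ #UDU-UD-UD (word α) ⟩
  #UDU (word α ++ U ∷ D ∷ []) + 1               ≡⟨ cong (λ w → #UDU w + 1) (word-snocD α ε) ⟨
  #UDU (word (snocD α ε)) + 1                   ≡⟨ cong (_+ 1) ih ⟩
  #FF+#FUD (φ (snocD α ε)) + 1                  ≡⟨ cong (λ w → #FF+#FUD w + 1) (φ-snocUD α) ⟩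
  #FF+#FUD (φ α ∷ʳ F) + 1                       ≡⟨ #FF+#FUD-split (λ ()) (φ α) [ F ] ⟨
  #FF+#FUD ((φ α ∷ʳ F) ∷ʳ F)                    ≡⟨ cong (#FF+#FUD ∘ (_∷ʳ F)) (φ-snocUD α) ⟨
  #FF+#FUD (φ (snocD α ε) ∷ʳ F)                 ≡⟨ cong #FF+#FUD (φ-snocUD (snocD α ε)) ⟨
  #FF+#FUD (φ (snocD (snocD α ε) ε))            ∎
  where open ≡-Reasoning

trailing-UUDD : ∀ α β γ → Separating α → #UDU (word α) ≡ #FF+#FUD (φ α) →
  #UDU (U ∷ word (node β γ) ++ D ∷ []) ≡ #FF+#FUD (φ γ ++ U ∷ φ β ++ D ∷ []) →
  #UDU (word (snocD α (node β γ))) ≡ #FF+#FUD (φ (snocD α (node β γ)))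
trailing-UUDD α β γ (#UDU-additive , #FF+#FUD-additive) ihα ihδ = begin
  #UDU (word (snocD α (node β γ)))                     ≡⟨ cong #UDU (word-snocD α (node β γ)) ⟩
  #UDU (word α ++ U ∷ word (node β γ) ++ D ∷ [])       ≡⟨ #UDU-additive _ ⟩
  #UDU (word α) + #UDU (U ∷ word (node β γ) ++ D ∷ []) ≡⟨ cong₂ _+_ ihα ihδ ⟩
  #FF+#FUD (φ α) + #FF+#FUD (φ γ ++ U ∷ φ β ++ D ∷ []) ≡⟨ #FF+#FUD-additive _ ⟨
  #FF+#FUD (φ α ++ φ γ ++ U ∷ φ β ++ D ∷ [])           ≡⟨ cong #FF+#FUD (φ-snocUUDD α β γ) ⟨
  #FF+#FUD (φ (snocD α (node β γ)))                    ∎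
  where open ≡-Reasoning

#UDU≡#FF+#FUD : ∀ {P} → LastReturn P → InDh P → #UDU (word P) ≡ #FF+#FUD (φ P)
#UDU≡#FF+#FUD ε _ = refl
#UDU≡#FF+#FUD (snocUD ε) _ = trailing-UD ε ε-separating refl
#UDU≡#FF+#FUD (snocUD (snocUD {α} vα)) i =
  trailing-UDUD α (#UDU≡#FF+#FUD (snocUD vα) (proj₁ (InDh-snocD _ ε i)))
#UDU≡#FF+#FUD (snocUD vα@(snocUUDD {α} {b} {g} _ _ _)) i =
  trailing-UD (snocD α (node b g)) (snocUUDD-separating α b g)
    (#UDU≡#FF+#FUD vα (proj₁ (InDh-snocD _ ε i)))
#UDU≡#FF+#FUD (snocUUDD {α} {β} {γ} vα vβ vγ) i with InDh-snocD α (node β γ) i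
... | iα , node-in iβ iγ h≤ =
  trailing-UUDD α β γ (separating vα i) (#UDU≡#FF+#FUD vα iα)
    (lastFactor vβ vγ h≤ (#UDU≡#FF+#FUD vβ iβ) (#UDU≡#FF+#FUD vγ iγ))

theorem8 : (n : ℕ) → (P : Dyck) → InDh P → semilength P ≡ n →
    count (U ∷ D ∷ U ∷ []) (word P) ≡ count (F ∷ F ∷ []) (φ P) + count (F ∷ U ∷ D ∷ []) (φ P)
theorem8 _ P i _ = #UDU≡#FF+#FUD (lastReturn P) i
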